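{- For every $t\ge 1$ and every $n\ge t+1$, $\chi^{\mathrm{CF}}_{\mathrm{tree}}(\mathrm{balls};t;n)\ge\lceil\log(t+1)\rceil$.
   Context: A network space is a 1-dimensional space with the topology of a graph (nodes are points, edges are simple curves of finite length joining pairs of nodes, otherwise disjoint); nodes of degree at least 3 are internal nodes. $d$ is the geodesic distance. A tree space is a network space whose graph is a tree. Balls are $B(p,r)=\{q: d(p,q)\le r\}$. For a set $\mathcal{A}$ of objects and a point $p$, $S_p=\{o\in\mathcal{A}:p\in o\}$; a coloring is conflict-free if for every $p$ with $S_p\ne\emptyset$ some object of $S_p$ has a color different from all other objects of $S_p$. $\chi^{\mathrm{CF}}_{\mathrm{tree}}(\mathrm{balls};t;n)$ is the minimum number of colors sufficient to CF-color any set of $n$ balls in any tree space with $t$ internal nodes. $\log$ is base 2. -}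

module Defs where

open import Data.Nat as ℕ using (ℕ; suc)
open import Data.Fin using (Fin)
open import Data.Fin.Properties using () renaming (_≟_ to _≟ᶠ_)
open import Data.List using (List; length; filter)
open import Data.List.Base using (allFin)
open import Data.Rational using (ℚ; 0ℚ; _+_; _-_; _<_; _≤_; ∣_∣)
open import Data.Product using (Σ; ∃; _×_)
open import Relation.Binary.PropositionalEquality using (_≡_; _≢_)
open import Relation.Nullary using (¬_)

-- A (finite) network given by its graph: m nodes, E edges, edge e joins
-- src e and tgt e (no loops) and is a simple curve of length len e > 0.
-- Lengths are rational.
record Network : Set where
  field
    m     : ℕ
    E     : ℕ
    src   : Fin E → Fin m
    tgt   : Fin E → Fin m
    noloop : ∀ e → src e ≢ tgt e
    len   : Fin E → ℚ
    len-pos : ∀ e → 0ℚ < len e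
open Network public

data NWalk (N : Network) : Fin (m N) → Fin (m N) → ℚ → Set where
  here : ∀ u → NWalk N u u 0ℚ
  fwd  : ∀ e {v ℓ} → NWalk N (tgt N e) v ℓ → NWalk N (src N e) v (len N e + ℓ)
  bwd  : ∀ e {v ℓ} → NWalk N (src N e) v ℓ → NWalk N (tgt N e) v (len N e + ℓ)

-- Points of the network space: a node, or an interior point of an edge e
-- at distance x from src e along e (0 < x < len e).
data Point (N : Network) : Set where
  node : Fin (m N) → Point N
  inner : (e : Fin (E N)) (x : ℚ) → 0ℚ < x → x < len N e → Point N

data PN (N : Network) : Point N → Fin (m N) → ℚ → Set where
  fromNode : ∀ {v u ℓ} → NWalk N v u ℓ → PN N (node v) u ℓ
  viaSrc : ∀ {e x p q u ℓ} → NWalk N (src N e) u ℓ → PN N (inner e x p q) u (x + ℓ)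
  viaTgt : ∀ {e x p q u ℓ} → NWalk N (tgt N e) u ℓ → PN N (inner e x p q) u ((len N e - x) + ℓ)

-- Paths between two points, with lengths.  The geodesic distance d(p,q)
-- is the minimum length of such a path, so d(p,q) ≤ r iff some path has
-- length ≤ r.
data Path (N : Network) : Point N → Point N → ℚ → Set where
  toNode : ∀ {p u ℓ} → PN N p u ℓ → Path N p (node u) ℓ
  enterSrc : ∀ {p e y a b ℓ} → PN N p (src N e) ℓ → Path N p (inner e y a b) (ℓ + y)
  enterTgt : ∀ {p e y a b ℓ} → PN N p (tgt N e) ℓ → Path N p (inner e y a b) (ℓ + (len N e - y))
  sameEdge : ∀ {e x a b y c d} → Path N (inner e x a b) (inner e y c d) ∣ x - y ∣

DistLe : (N : Network) → Point N → Point N → ℚ → Set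
DistLe N p q r = ∃ λ ℓ → Path N p q ℓ × ℓ ≤ r

degree : (N : Network) → Fin (m N) → ℕ
degree N v = length (filter (λ e → src N e ≟ᶠ v) (allFin (E N)))
           ℕ.+ length (filter (λ e → tgt N e ≟ᶠ v) (allFin (E N)))

internalNodes : Network → ℕ
internalNodes N = length (filter (λ v → 3 ℕ.≤? degree N v) (allFin (m N)))

IsTree : Network → Set
IsTree N = (suc (E N) ≡ m N) × (∀ u v → ∃ λ ℓ → NWalk N u v ℓ)

record Ball (N : Network) : Set where
  constructor ball
  field
    center : Point N
    radius : ℚ
    radius-pos : 0ℚ < radius
open Ball public

_∈B_ : ∀ {N} → Point N → Ball N → Set
_∈B_ {N} p b = DistLe N (center b) p (radius b)

SameSet : ∀ {N} → Ball N → Ball N → Set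
SameSet {N} b b' = ∀ (p : Point N) → ((p ∈B b) → (p ∈B b')) × ((p ∈B b') → (p ∈B b))

-- A set of n balls: a family indexed by Fin n of pairwise distinct balls.
Distinct : ∀ {N n} → (Fin n → Ball N) → Set
Distinct {n = n} B = ∀ (i j : Fin n) → i ≢ j → ¬ SameSet (B i) (B j)

ConflictFree : ∀ {N n c} → (Fin n → Ball N) → (Fin n → Fin c) → Set
ConflictFree {N} {n} B col =
  ∀ (p : Point N) → (∃ λ i → p ∈B B i) →
    ∃ λ i → (p ∈B B i) × (∀ j → j ≢ i → p ∈B B j → col j ≢ col i)

CFColorable : ∀ {N n} → (Fin n → Ball N) → ℕ → Set
CFColorable {n = n} B c = ∃ λ (col : Fin n → Fin c) → ConflictFree B col

Sufficient : ℕ → ℕ → ℕ → Set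
Sufficient t n c = ∀ (N : Network) → IsTree N → internalNodes N ≡ t →
  ∀ (B : Fin n → Ball N) → Distinct B → CFColorable B c

-- If 2 ^ c > t the bound is immediate, so let K = 2 ^ c ≤ t.  Take a caterpillar: a path of t + 2
-- spine nodes, each carrying a pendant leg, so that exactly t nodes have degree 3.  The first K spine
-- nodes are placed hierarchically: the two halves of a dyadic block of level a + 1 are more than
-- 2 ρ a apart, while a block of level b has diameter at most ρ b.  For balls of radius ρ c + 1 around
-- them, every dyadic block has a witness point on a leg lying in exactly the balls of that block; the
-- remaining n ∸ K balls are nested balls around the far leaf of the last leg.  A conflict-free colouring
-- therefore gives every dyadic block of [0, K) a uniquely coloured ball, and that needs c + 1 colours:
-- the colour unique on a block is absent from one of its halves, where we recurse.  Distances are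
-- bounded from below by potentials that change by exactly the edge length along every edge.
module Submission where

open import Defs

module Arithmetic where

  open import Data.Nat
  open import Data.Nat.Properties
  open import Data.Nat.Solver using (module +-*-Solver)
  open import Data.Sum using (inj₁; inj₂)
  open import Relation.Binary.PropositionalEquality
  open +-*-Solver

  m≤n+o⇒n≤m+o⇒∣m-n∣≤o : ∀ {m n o} → m ≤ n + o → n ≤ m + o → ∣ m - n ∣ ≤ o
  m≤n+o⇒n≤m+o⇒∣m-n∣≤o {m} {n} m≤n+o n≤m+o with ∣m-n∣≡[m∸n]∨[n∸m] m n
  ... | inj₁ eq rewrite eq = m≤n+o⇒m∸n≤o m n m≤n+o
  ... | inj₂ eq rewrite eq = m≤n+o⇒m∸n≤o n m n≤m+o

  m+o<n⇒o<∣n-m∣ : ∀ {m n o} → m + o < n → o < ∣ n - m ∣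
  m+o<n⇒o<∣n-m∣ {m} {n} {o} m+o<n rewrite m≤n⇒∣n-m∣≡n∸m (≤-trans (m≤m+n m o) (<⇒≤ m+o<n)) =
    m+n≤o⇒m≤o∸n (suc o) (subst (_≤ n) (cong suc (+-comm m o)) m+o<n)

  m+h≤n+[o+h]⇒m≤n+o : ∀ m n o h → m + h ≤ n + (o + h) → m ≤ n + o
  m+h≤n+[o+h]⇒m≤n+o m n o h le = +-cancelʳ-≤ h m (n + o) (subst (m + h ≤_) (sym (+-assoc n o h)) le)

  +-rightComm : ∀ a b c → a + b + c ≡ a + c + b
  +-rightComm = solve 3 (λ a b c → a :+ b :+ c := a :+ c :+ b) refl

  ∸-telescope : ∀ {a b c} → a ≤ b → b ≤ c → (c ∸ b) + (b ∸ a) ≡ c ∸ a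
  ∸-telescope {a} {b} {c} a≤b b≤c = trans (sym (+-∸-assoc (c ∸ b) a≤b)) (cong (_∸ a) (m∸n+n≡m b≤c))

  ∸-flip : ∀ {T a b h r} → a ≤ T → b ≤ T → (T ∸ a) + h ≤ (T ∸ b) + r → b + h ≤ a + r
  ∸-flip {T} {a} {b} {h} {r} a≤T b≤T le = +-cancelˡ-≤ T (b + h) (a + r) (begin
    T + (b + h)                  ≡⟨ cong (_+ (b + h)) (m∸n+n≡m a≤T) ⟨
    (T ∸ a) + a + (b + h)        ≡⟨ solve 4 (λ d a b h → (d :+ a) :+ (b :+ h) := (d :+ h) :+ (a :+ b)) refl (T ∸ a) a b h ⟩
    ((T ∸ a) + h) + (a + b)      ≤⟨ +-monoˡ-≤ (a + b) le ⟩
    ((T ∸ b) + r) + (a + b)      ≡⟨ solve 4 (λ d a b r → (d :+ r) :+ (a :+ b) := (d :+ b) :+ (a :+ r)) refl (T ∸ b) a b r ⟩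
    (T ∸ b) + b + (a + r)        ≡⟨ cong (_+ (a + r)) (m∸n+n≡m b≤T) ⟩
    T + (a + r)                  ∎)
    where open ≤-Reasoning

module DyadicBlocks where

  open import Data.Nat
  open import Data.Nat.Properties
  open import Data.Fin using (Fin; zero; suc; punchOut)
  open import Data.Fin.Properties using (toℕ<n; punchOut-injective) renaming (_≟_ to _≟ᶠ_)
  open import Data.Product using (∃; ∃₂; _×_; _,_; proj₁; proj₂)
  open import Data.Sum using (_⊎_; inj₁; inj₂)
  open import Data.Empty using (⊥-elim)
  open import Relation.Nullary using (Dec; yes; no)
  open import Relation.Nullary.Decidable using (_×-dec_)
  open import Relation.Binary.PropositionalEquality
  open import Function using (_∘_)

  -- Dyadic a b o: the interval [o, o + 2 ^ b) is a dyadic block of [0, 2 ^ a).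
  data Dyadic : ℕ → ℕ → ℕ → Set where
    whole : ∀ {a} → Dyadic a a 0
    lower : ∀ {a b o} → Dyadic a b o → Dyadic (suc a) b o
    upper : ∀ {a b o} → Dyadic a b o → Dyadic (suc a) b (2 ^ a + o)

  2^suc : ∀ a → 2 ^ suc a ≡ 2 ^ a + 2 ^ a
  2^suc a = cong (2 ^ a +_) (+-identityʳ (2 ^ a))

  lower-or-upper : ∀ a i → i < 2 ^ a ⊎ ∃ λ j → i ≡ 2 ^ a + j
  lower-or-upper a i with i <? 2 ^ a
  ... | yes i<2^a = inj₁ i<2^a
  ... | no i≮2^a = inj₂ (i ∸ 2 ^ a , sym (m+[n∸m]≡n (≮⇒≥ i≮2^a)))

  upper-< : ∀ a {j} → 2 ^ a + j < 2 ^ suc a → j < 2 ^ a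
  upper-< a {j} lt = +-cancelˡ-< (2 ^ a) j (2 ^ a) (subst (2 ^ a + j <_) (2^suc a) lt)

  Dyadic-end≤ : ∀ {a b o} → Dyadic a b o → o + 2 ^ b ≤ 2 ^ a
  Dyadic-end≤ whole = ≤-refl
  Dyadic-end≤ {suc a} (lower d) rewrite 2^suc a = ≤-trans (Dyadic-end≤ d) (m≤m+n (2 ^ a) (2 ^ a))
  Dyadic-end≤ {suc a} {b} (upper {o = o} d) rewrite 2^suc a | +-assoc (2 ^ a) o (2 ^ b) =
    +-monoʳ-≤ (2 ^ a) (Dyadic-end≤ d)

  Dyadic-start< : ∀ {a b o} → Dyadic a b o → o < 2 ^ a
  Dyadic-start< {b = b} {o} d = <-≤-trans (m<m+n o (m^n>0 2 b)) (Dyadic-end≤ d)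

  Dyadic-level≤ : ∀ {a b o} → Dyadic a b o → b ≤ a
  Dyadic-level≤ whole = ≤-refl
  Dyadic-level≤ (lower d) = m≤n⇒m≤1+n (Dyadic-level≤ d)
  Dyadic-level≤ (upper d) = m≤n⇒m≤1+n (Dyadic-level≤ d)

  Dyadic-unit : ∀ a {i} → i < 2 ^ a → Dyadic a 0 i
  Dyadic-unit zero {zero} _ = whole
  Dyadic-unit zero {suc i} (s≤s ())
  Dyadic-unit (suc a) {i} i<2^a+1 with lower-or-upper a i
  ... | inj₁ i<2^a = lower (Dyadic-unit a i<2^a)
  ... | inj₂ (j , refl) = upper (Dyadic-unit a (upper-< a i<2^a+1))

  InRange : ℕ → ℕ → ℕ → Set
  InRange o w i = o ≤ i × i < o + w

  InRange-unit : ∀ {o i} → InRange o 1 i → i ≡ o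
  InRange-unit {o} {i} (o≤i , i<o+1) = ≤-antisym (m<1+n⇒m≤n (subst (i <_) (+-comm o 1) i<o+1)) o≤i

  InRange-start : ∀ o {w} → 0 < w → InRange o w o
  InRange-start o 0<w = ≤-refl , m<m+n o 0<w

  InRange-⊆ : ∀ {o w h v j} → o ≤ h → h + v ≤ o + w → InRange h v j → InRange o w j
  InRange-⊆ o≤h end≤ (h≤j , j<h+v) = ≤-trans o≤h h≤j , <-≤-trans j<h+v end≤

  InRange-shift⁺ : ∀ m {o w j} → InRange o w j → InRange (m + o) w (m + j)
  InRange-shift⁺ m {o} {w} {j} (o≤j , j<o+w) = +-monoʳ-≤ m o≤j , subst (m + j <_) (sym (+-assoc m o w)) (+-monoʳ-< m j<o+w)

  InRange-shift⁻ : ∀ m {o w j} → InRange (m + o) w (m + j) → InRange o w j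
  InRange-shift⁻ m {o} {w} {j} (o≤j , j<o+w) = +-cancelˡ-≤ m o j o≤j , +-cancelˡ-< m j (o + w) (subst (m + j <_) (+-assoc m o w) j<o+w)

  InRange? : ∀ o w i → Dec (InRange o w i)
  InRange? o w i = (o ≤? i) ×-dec (i <? o + w)

  HasUniqueColour : ∀ {C : Set} → (ℕ → C) → ℕ → ℕ → Set
  HasUniqueColour col o w = ∃ λ i → InRange o w i × (∀ j → InRange o w j → j ≢ i → col j ≢ col i)

  AllDyadicUnique : ∀ {C : Set} → (ℕ → C) → ℕ → ℕ → Set
  AllDyadicUnique col a o = ∀ {b o'} → Dyadic a b o' → HasUniqueColour col (o + o') (2 ^ b)

  whole-unique : ∀ {C : Set} {col : ℕ → C} {a o} → AllDyadicUnique col a o → HasUniqueColour col o (2 ^ a)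
  whole-unique {col = col} {a} {o} H = subst (λ x → HasUniqueColour col x (2 ^ a)) (+-identityʳ o) (H whole)

  -- κ is the colour that is unique on the whole block, so it is absent from the half not containing it.
  half-avoiding-unique : ∀ {C : Set} (col : ℕ → C) a o → AllDyadicUnique col (suc a) o →
    ∃₂ λ h κ → AllDyadicUnique col a h × (∀ j → InRange h (2 ^ a) j → col j ≢ κ)
  half-avoiding-unique col a o H with whole-unique H
  ... | i , _ , unique with i <? o + 2 ^ a
  ... | yes i<mid = o + 2 ^ a , col i , upperUnique , λ j j∈ → unique j (inWhole j∈) (λ { refl → <⇒≱ i<mid (proj₁ j∈) })
    where
    upperUnique : AllDyadicUnique col a (o + 2 ^ a)
    upperUnique {b} {o'} d = subst (λ x → HasUniqueColour col x (2 ^ b)) (sym (+-assoc o (2 ^ a) o')) (H (upper d))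
    inWhole : ∀ {j} → InRange (o + 2 ^ a) (2 ^ a) j → InRange o (2 ^ suc a) j
    inWhole = InRange-⊆ (m≤m+n o (2 ^ a)) (≤-reflexive (trans (+-assoc o (2 ^ a) (2 ^ a)) (cong (o +_) (sym (2^suc a)))))
  ... | no i≮mid = o , col i , (λ d → H (lower d)) , λ j j∈ → unique j (inWhole j∈) (λ { refl → i≮mid (proj₂ j∈) })
    where
    inWhole : ∀ {j} → InRange o (2 ^ a) j → InRange o (2 ^ suc a) j
    inWhole = InRange-⊆ ≤-refl (+-monoʳ-≤ o (^-monoʳ-≤ 2 (n≤1+n a)))

  removeColour : ∀ {k} → Fin (suc (suc k)) → Fin (suc (suc k)) → Fin (suc k)
  removeColour κ x with κ ≟ᶠ x
  ... | yes _ = zero  -- junk value: colours equal to κ are never removed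
  ... | no κ≢x = punchOut κ≢x

  removeColour-injective : ∀ {k} {κ x y : Fin (suc (suc k))} → κ ≢ x → κ ≢ y →
    removeColour κ x ≡ removeColour κ y → x ≡ y
  removeColour-injective {κ = κ} {x} {y} κ≢x κ≢y eq with κ ≟ᶠ x | κ ≟ᶠ y
  ... | yes κ≡x | _ = ⊥-elim (κ≢x κ≡x)
  ... | no _ | yes κ≡y = ⊥-elim (κ≢y κ≡y)
  ... | no κ≢x′ | no κ≢y′ = punchOut-injective κ≢x′ κ≢y′ eq

  HasUniqueColour-removeColour : ∀ {k} {col : ℕ → Fin (suc (suc k))} {κ o w} →
    (∀ j → InRange o w j → col j ≢ κ) →
    HasUniqueColour col o w → HasUniqueColour (removeColour κ ∘ col) o w
  HasUniqueColour-removeColour avoid (i , i∈ , unique) =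
    i , i∈ , λ j j∈ j≢i eq → unique j j∈ j≢i (removeColour-injective (avoid j j∈ ∘ sym) (avoid i i∈ ∘ sym) eq)

  AllDyadicUnique⇒< : ∀ a o {k} (col : ℕ → Fin k) → AllDyadicUnique col a o → a < k
  AllDyadicUnique⇒< zero o col H with whole-unique H
  ... | i , _ = ≤-<-trans z≤n (toℕ<n (col i))
  AllDyadicUnique⇒< (suc a) o {zero} col H with col 0
  ... | ()
  AllDyadicUnique⇒< (suc a) o {suc zero} col H with half-avoiding-unique col a o H
  ... | h , zero , _ , avoid with col h | avoid h (InRange-start h (m^n>0 2 a))
  ... | zero | h≢κ = ⊥-elim (h≢κ refl)
  AllDyadicUnique⇒< (suc a) o {suc (suc k)} col H with half-avoiding-unique col a o H
  ... | h , κ , Hh , avoid =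
    s≤s (AllDyadicUnique⇒< a h (removeColour κ ∘ col) λ d → HasUniqueColour-removeColour (avoid-in d) (Hh d))
    where
    avoid-in : ∀ {b o'} → Dyadic a b o' → ∀ j → InRange (h + o') (2 ^ b) j → col j ≢ κ
    avoid-in {b} {o'} d j j∈ = avoid j (InRange-⊆ (m≤m+n h o')
      (≤-trans (≤-reflexive (+-assoc h o' (2 ^ b))) (+-monoʳ-≤ h (Dyadic-end≤ d))) j∈)

module Layout where

  open import Data.Nat
  open import Data.Nat.Properties
  open import Data.Product using (_,_; proj₁; proj₂)
  open import Data.Sum using (inj₁; inj₂)
  open import Data.Empty using (⊥-elim)
  open import Relation.Nullary using (¬_; yes; no)
  open import Relation.Binary.PropositionalEquality
  open import Function using (_∘_)
  open Arithmetic
  open DyadicBlocks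

  ρ gap : ℕ → ℕ
  ρ zero = 0
  ρ (suc a) = gap a + ρ a
  gap a = suc (ρ a + ρ a)

  -- The upper half of a level-(a+1) block is shifted by gap a, so that points of different halves
  -- are more than 2 ρ a apart.
  pos : ℕ → ℕ → ℕ
  pos zero i = i
  pos (suc a) i with i <? 2 ^ a
  ... | yes _ = pos a i
  ... | no _ = gap a + pos a (i ∸ 2 ^ a)

  pos-lower : ∀ a {i} → i < 2 ^ a → pos (suc a) i ≡ pos a i
  pos-lower a {i} i<2^a with i <? 2 ^ a
  ... | yes _ = refl
  ... | no i≮2^a = ⊥-elim (i≮2^a i<2^a)

  pos-upper : ∀ a j → pos (suc a) (2 ^ a + j) ≡ gap a + pos a j
  pos-upper a j with 2 ^ a + j <? 2 ^ a
  ... | yes lt = ⊥-elim (m+n≮m (2 ^ a) j lt)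
  ... | no _ = cong (λ k → gap a + pos a k) (m+n∸m≡n (2 ^ a) j)

  pos-zero : ∀ a → pos a 0 ≡ 0
  pos-zero zero = refl
  pos-zero (suc a) = trans (pos-lower a (m^n>0 2 a)) (pos-zero a)

  ρ<gap : ∀ a → ρ a < gap a
  ρ<gap a = s≤s (m≤m+n (ρ a) (ρ a))

  ρ-mono : ∀ {a b} → b ≤ a → ρ b ≤ ρ a
  ρ-mono {zero} z≤n = ≤-refl
  ρ-mono {suc a} b≤1+a with m≤n⇒m<n∨m≡n b≤1+a
  ... | inj₁ b<1+a = ≤-trans (ρ-mono (m<1+n⇒m≤n b<1+a)) (m≤n+m (ρ a) (gap a))
  ... | inj₂ refl = ≤-refl

  pos≤ρ : ∀ a {i} → i < 2 ^ a → pos a i ≤ ρ a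
  pos≤ρ zero {zero} _ = z≤n
  pos≤ρ zero {suc i} (s≤s ())
  pos≤ρ (suc a) {i} i<2^a+1 with lower-or-upper a i
  ... | inj₁ i<2^a rewrite pos-lower a i<2^a = ≤-trans (pos≤ρ a i<2^a) (m≤n+m (ρ a) (gap a))
  ... | inj₂ (j , refl) rewrite pos-upper a j = +-monoʳ-≤ (gap a) (pos≤ρ a (upper-< a i<2^a+1))

  pos-strictMono : ∀ a {i j} → i < j → pos a i < pos a j
  pos-strictMono zero i<j = i<j
  pos-strictMono (suc a) {i} {j} i<j with lower-or-upper a i | lower-or-upper a j
  ... | inj₁ i< | inj₁ j< rewrite pos-lower a i< | pos-lower a j< = pos-strictMono a i<j
  ... | inj₁ i< | inj₂ (j′ , refl) rewrite pos-lower a i< | pos-upper a j′ =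
    <-≤-trans (≤-<-trans (pos≤ρ a i<) (ρ<gap a)) (m≤m+n (gap a) (pos a j′))
  ... | inj₂ (i′ , refl) | inj₁ j< = ⊥-elim (<⇒≱ (<-trans i<j j<) (m≤m+n (2 ^ a) i′))
  ... | inj₂ (i′ , refl) | inj₂ (j′ , refl) rewrite pos-upper a i′ | pos-upper a j′ =
    +-monoʳ-< (gap a) (pos-strictMono a (+-cancelˡ-< (2 ^ a) i′ j′ i<j))

  gap-separates : ∀ a {b x j} → x ≤ ρ a → b ≤ a → x + ρ b < gap a + j
  gap-separates a {b} x≤ρa b≤a = <-≤-trans (s≤s (+-mono-≤ x≤ρa (ρ-mono b≤a))) (m≤m+n (gap a) _)

  pos-near : ∀ {a b o i} → Dyadic a b o → InRange o (2 ^ b) i → ∣ pos a i - pos a o ∣ ≤ ρ b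
  pos-near {a} {i = i} whole (_ , i<2^a) rewrite pos-zero a | ∣-∣-identityʳ (pos a i) = pos≤ρ a i<2^a
  pos-near {suc a} {b} {o} {i} (lower d) i∈ rewrite pos-lower a (<-≤-trans (proj₂ i∈) (Dyadic-end≤ d))
    | pos-lower a (Dyadic-start< d) = pos-near d i∈
  pos-near {suc a} {b} {_} {i} (upper {o = o} d) i∈ with lower-or-upper a i
  ... | inj₁ i< = ⊥-elim (<⇒≱ i< (≤-trans (m≤m+n (2 ^ a) o) (proj₁ i∈)))
  ... | inj₂ (j , refl) rewrite pos-upper a j | pos-upper a o | ∣m+n-m+o∣≡∣n-o∣ (gap a) (pos a j) (pos a o) =
    pos-near d (InRange-shift⁻ (2 ^ a) i∈)

  pos-far : ∀ {a b o i} → Dyadic a b o → i < 2 ^ a → ¬ InRange o (2 ^ b) i → ρ b < ∣ pos a i - pos a o ∣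
  pos-far whole i< i∉ = ⊥-elim (i∉ (z≤n , i<))
  pos-far {suc a} {b} {o} {i} (lower d) i<2^a+1 i∉ with lower-or-upper a i
  ... | inj₁ i< rewrite pos-lower a i< | pos-lower a (Dyadic-start< d) = pos-far d i< i∉
  ... | inj₂ (j , refl) rewrite pos-upper a j | pos-lower a (Dyadic-start< d) =
    m+o<n⇒o<∣n-m∣ (gap-separates a (pos≤ρ a (Dyadic-start< d)) (Dyadic-level≤ d))
  pos-far {suc a} {b} {_} {i} (upper {o = o} d) i<2^a+1 i∉ with lower-or-upper a i
  ... | inj₁ i< rewrite pos-lower a i< | pos-upper a o | ∣-∣-comm (pos a i) (gap a + pos a o) =
    m+o<n⇒o<∣n-m∣ (gap-separates a (pos≤ρ a i<) (Dyadic-level≤ d))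
  ... | inj₂ (j , refl) rewrite pos-upper a j | pos-upper a o | ∣m+n-m+o∣≡∣n-o∣ (gap a) (pos a j) (pos a o) =
    pos-far d (upper-< a i<2^a+1) (i∉ ∘ InRange-shift⁺ (2 ^ a))

module Rationals where

  open import Data.Nat as ℕ using (ℕ; zero; suc)
  import Data.Nat.Properties as ℕ
  import Data.Integer as ℤ
  open import Data.Rational
  open import Data.Rational.Properties
  open import Data.Sum using (inj₁; inj₂)
  open import Relation.Nullary using (yes; no; contradiction)
  open import Relation.Binary.PropositionalEquality
  open import Data.Rational.Solver using (module +-*-Solver)
  open +-*-Solver

  toℚ : ℕ → ℚ
  toℚ zero = 0ℚ
  toℚ (suc n) = 1ℚ + toℚ n

  toℚ-+ : ∀ m n → toℚ (m ℕ.+ n) ≡ toℚ m + toℚ n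
  toℚ-+ zero n = sym (+-identityˡ (toℚ n))
  toℚ-+ (suc m) n = trans (cong (1ℚ +_) (toℚ-+ m n)) (sym (+-assoc 1ℚ (toℚ m) (toℚ n)))

  toℚ-∸ : ∀ {m n} → n ℕ.≤ m → toℚ (m ℕ.∸ n) ≡ toℚ m - toℚ n
  toℚ-∸ {m} {n} n≤m = begin
    toℚ (m ℕ.∸ n)                        ≡⟨ solve 2 (λ d k → d := d :+ k :- k) refl (toℚ (m ℕ.∸ n)) (toℚ n) ⟩
    toℚ (m ℕ.∸ n) + toℚ n - toℚ n        ≡⟨ cong (_- toℚ n) (toℚ-+ (m ℕ.∸ n) n) ⟨
    toℚ (m ℕ.∸ n ℕ.+ n) - toℚ n          ≡⟨ cong (λ k → toℚ k - toℚ n) (ℕ.m∸n+n≡m n≤m) ⟩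
    toℚ m - toℚ n                        ∎
    where open ≡-Reasoning

  0<1 : 0ℚ < 1ℚ
  0<1 = *<* (ℤ.+<+ (ℕ.s≤s ℕ.z≤n))

  x<1+x : ∀ x → x < 1ℚ + x
  x<1+x x = <-respˡ-≡ (+-identityˡ x) (+-monoˡ-< x 0<1)

  toℚ-strictMono : ∀ {m n} → m ℕ.< n → toℚ m < toℚ n
  toℚ-strictMono {m} {suc n} m<1+n with ℕ.m<1+n⇒m<n∨m≡n m<1+n
  ... | inj₁ m<n = <-trans (toℚ-strictMono m<n) (x<1+x (toℚ n))
  ... | inj₂ refl = x<1+x (toℚ n)

  toℚ-mono-≤ : ∀ {m n} → m ℕ.≤ n → toℚ m ≤ toℚ n
  toℚ-mono-≤ m≤n with ℕ.m≤n⇒m<n∨m≡n m≤n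
  ... | inj₁ m<n = <⇒≤ (toℚ-strictMono m<n)
  ... | inj₂ refl = ≤-refl

  toℚ-cancel-≤ : ∀ {m n} → toℚ m ≤ toℚ n → m ℕ.≤ n
  toℚ-cancel-≤ {m} {n} le with m ℕ.≤? n
  ... | yes m≤n = m≤n
  ... | no m≰n = contradiction (≤-<-trans le (toℚ-strictMono (ℕ.≰⇒> m≰n))) (<-irrefl refl)

  toℚ-cancel-+-≤ : ∀ a b c d → toℚ a + toℚ b ≤ toℚ c + toℚ d → a ℕ.+ b ℕ.≤ c ℕ.+ d
  toℚ-cancel-+-≤ a b c d le = toℚ-cancel-≤ (subst₂ _≤_ (sym (toℚ-+ a b)) (sym (toℚ-+ c d)) le)

  toℚ-pos : ∀ n → 0ℚ < toℚ (suc n)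
  toℚ-pos n = toℚ-strictMono {0} {suc n} (ℕ.s≤s ℕ.z≤n)

  p<q⇒0<q-p : ∀ {p q} → p < q → 0ℚ < q - p
  p<q⇒0<q-p {p} p<q = <-respˡ-≡ (+-inverseʳ p) (+-monoˡ-< (- p) p<q)

  ∣p-q∣≡∣q-p∣ : ∀ p q → ∣ p - q ∣ ≡ ∣ q - p ∣
  ∣p-q∣≡∣q-p∣ p q = trans (cong ∣_∣ (solve 2 (λ p q → p :- q := :- (q :- p)) refl p q)) (∣-p∣≡∣p∣ (q - p))

  x<x+p : ∀ x {p} → 0ℚ < p → x < x + p
  x<x+p x 0<p = <-respˡ-≡ (+-identityʳ x) (+-monoʳ-< x 0<p)

  p≤∣p∣ : ∀ p → p ≤ ∣ p ∣
  p≤∣p∣ (mkℚ (ℤ.+ _) _ _) = ≤-refl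
  p≤∣p∣ (mkℚ ℤ.-[1+ _ ] _ _) = *≤* ℤ.-≤+

module Potential where

  open import Data.Fin using (Fin)
  open import Data.Rational
  open import Data.Rational.Properties
  open import Data.Rational.Solver using (module +-*-Solver)
  open import Data.Product using (_,_)
  open import Data.Sum using (_⊎_; inj₁; inj₂)
  open import Relation.Nullary using (contradiction)
  open import Relation.Binary.PropositionalEquality
  open +-*-Solver
  open Rationals

  -- Tight potentials bound geodesic distances from below (extend-≤-dist).
  TightOn : (N : Network) → (Fin (m N) → ℚ) → Fin (E N) → Set
  TightOn N φ e = φ (tgt N e) ≡ φ (src N e) + len N e ⊎ φ (src N e) ≡ φ (tgt N e) + len N e

  Tight : (N : Network) → (Fin (m N) → ℚ) → Set
  Tight N φ = ∀ e → TightOn N φ e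

  -- u ≤ v + ℓ, wrapped in a record so that u, v and ℓ can be recovered by unification.
  record Bound (u v ℓ : ℚ) : Set where
    constructor bound
    field ≤-bound : u ≤ v + ℓ
  open Bound public

  Bound-trans : ∀ {u v w ℓ ℓ′} → Bound u v ℓ → Bound v w ℓ′ → Bound u w (ℓ′ + ℓ)
  Bound-trans {w = w} {ℓ} {ℓ′} (bound u≤v+ℓ) (bound v≤w+ℓ′) =
    bound (≤-trans u≤v+ℓ (≤-trans (+-monoˡ-≤ ℓ v≤w+ℓ′) (≤-reflexive (+-assoc w ℓ′ ℓ))))

  Bound-∣-∣ : ∀ u v {d} → ∣ u - v ∣ ≡ d → Bound u v d
  Bound-∣-∣ u v refl = bound (≤-trans (≤-reflexive (solve 2 (λ u v → u := v :+ (u :- v)) refl u v)) (+-monoʳ-≤ v (p≤∣p∣ (u - v))))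

  Bound-∣-∣′ : ∀ u v {d} → ∣ u - v ∣ ≡ d → Bound v u d
  Bound-∣-∣′ u v eq = Bound-∣-∣ v u (trans (∣p-q∣≡∣q-p∣ v u) eq)

  0<p⇒∣p∣≡p : ∀ {p} → 0ℚ < p → ∣ p ∣ ≡ p
  0<p⇒∣p∣≡p 0<p = 0≤p⇒∣p∣≡p (<⇒≤ 0<p)

  module Extension (N : Network) (φ : Fin (m N) → ℚ) (tight : Tight N φ) where

    slope : Fin (E N) → ℚ → ℚ
    slope e with tight e
    ... | inj₁ _ = λ x → x
    ... | inj₂ _ = -_

    extend : Point N → ℚ
    extend (node v) = φ v
    extend (inner e x _ _) = φ (src N e) + slope e x

    ∣slope∣ : ∀ e x → ∣ slope e x ∣ ≡ ∣ x ∣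
    ∣slope∣ e x with tight e
    ... | inj₁ _ = refl
    ... | inj₂ _ = ∣-p∣≡∣p∣ x

    slope-linear : ∀ e x y → slope e x - slope e y ≡ slope e (x - y)
    slope-linear e x y with tight e
    ... | inj₁ _ = refl
    ... | inj₂ _ = solve 2 (λ x y → :- x :- :- y := :- (x :- y)) refl x y

    tgt-src≡slope : ∀ e → φ (tgt N e) - φ (src N e) ≡ slope e (len N e)
    tgt-src≡slope e with tight e
    ... | inj₁ up = trans (cong (_- φ (src N e)) up) (solve 2 (λ a L → a :+ L :- a := L) refl (φ (src N e)) (len N e))
    ... | inj₂ down = trans (cong (λ z → φ (tgt N e) - z) down) (solve 2 (λ b L → b :- (b :+ L) := :- L) refl (φ (tgt N e)) (len N e))

    ∣tgt-src∣ : ∀ e → ∣ φ (tgt N e) - φ (src N e) ∣ ≡ len N e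
    ∣tgt-src∣ e = trans (cong ∣_∣ (tgt-src≡slope e)) (trans (∣slope∣ e (len N e)) (0<p⇒∣p∣≡p (len-pos N e)))

    ∣extend-src∣ : ∀ e x a b → ∣ extend (inner e x a b) - φ (src N e) ∣ ≡ x
    ∣extend-src∣ e x a _ = begin
      ∣ φ (src N e) + slope e x - φ (src N e) ∣  ≡⟨ cong ∣_∣ (solve 2 (λ u s → u :+ s :- u := s) refl (φ (src N e)) (slope e x)) ⟩
      ∣ slope e x ∣                             ≡⟨ ∣slope∣ e x ⟩
      ∣ x ∣                                     ≡⟨ 0<p⇒∣p∣≡p a ⟩
      x                                         ∎
      where open ≡-Reasoning

    ∣extend-tgt∣ : ∀ e x a b → ∣ extend (inner e x a b) - φ (tgt N e) ∣ ≡ len N e - x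
    ∣extend-tgt∣ e x _ b = begin
      ∣ φ (src N e) + slope e x - φ (tgt N e) ∣
        ≡⟨ cong ∣_∣ (solve 3 (λ u s t → u :+ s :- t := s :- (t :- u)) refl (φ (src N e)) (slope e x) (φ (tgt N e))) ⟩
      ∣ slope e x - (φ (tgt N e) - φ (src N e)) ∣           ≡⟨ cong (λ z → ∣ slope e x - z ∣) (tgt-src≡slope e) ⟩
      ∣ slope e x - slope e (len N e) ∣                     ≡⟨ cong ∣_∣ (slope-linear e x (len N e)) ⟩
      ∣ slope e (x - len N e) ∣                             ≡⟨ ∣slope∣ e (x - len N e) ⟩
      ∣ x - len N e ∣                                       ≡⟨ ∣p-q∣≡∣q-p∣ x (len N e) ⟩
      ∣ len N e - x ∣                                       ≡⟨ 0<p⇒∣p∣≡p (p<q⇒0<q-p b) ⟩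
      len N e - x                                           ∎
      where open ≡-Reasoning

    ∣extend-extend∣ : ∀ e x a b y c d → ∣ extend (inner e y c d) - extend (inner e x a b) ∣ ≡ ∣ x - y ∣
    ∣extend-extend∣ e x _ _ y _ _ = begin
      ∣ φ (src N e) + slope e y - (φ (src N e) + slope e x) ∣
        ≡⟨ cong ∣_∣ (solve 3 (λ u s r → u :+ s :- (u :+ r) := s :- r) refl (φ (src N e)) (slope e y) (slope e x)) ⟩
      ∣ slope e y - slope e x ∣                               ≡⟨ cong ∣_∣ (slope-linear e y x) ⟩
      ∣ slope e (y - x) ∣                                     ≡⟨ ∣slope∣ e (y - x) ⟩
      ∣ y - x ∣                                               ≡⟨ ∣p-q∣≡∣q-p∣ y x ⟩
      ∣ x - y ∣                                               ∎
      where open ≡-Reasoning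

    walk-bound : ∀ {u v ℓ} → NWalk N u v ℓ → Bound (φ v) (φ u) ℓ
    walk-bound (here u) = bound (≤-reflexive (sym (+-identityʳ (φ u))))
    walk-bound (fwd e w) = Bound-trans (walk-bound w) (Bound-∣-∣ (φ (tgt N e)) (φ (src N e)) (∣tgt-src∣ e))
    walk-bound (bwd e w) = Bound-trans (walk-bound w) (Bound-∣-∣′ (φ (tgt N e)) (φ (src N e)) (∣tgt-src∣ e))

    pointToNode-bound : ∀ {p u ℓ} → PN N p u ℓ → Bound (φ u) (extend p) ℓ
    pointToNode-bound (fromNode w) = walk-bound w
    pointToNode-bound {p} (viaSrc {e} {x} {a} {b} w) =
      Bound-trans (walk-bound w) (Bound-∣-∣′ (extend p) (φ (src N e)) (∣extend-src∣ e x a b))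
    pointToNode-bound {p} (viaTgt {e} {x} {a} {b} w) =
      Bound-trans (walk-bound w) (Bound-∣-∣′ (extend p) (φ (tgt N e)) (∣extend-tgt∣ e x a b))

    path-bound : ∀ {p r ℓ} → Path N p r ℓ → Bound (extend r) (extend p) ℓ
    path-bound (toNode w) = pointToNode-bound w
    path-bound {r = r} (enterSrc {e = e} {y} {a} {b} w) =
      Bound-trans (Bound-∣-∣ (extend r) (φ (src N e)) (∣extend-src∣ e y a b)) (pointToNode-bound w)
    path-bound {r = r} (enterTgt {e = e} {y} {a} {b} w) =
      Bound-trans (Bound-∣-∣ (extend r) (φ (tgt N e)) (∣extend-tgt∣ e y a b)) (pointToNode-bound w)
    path-bound {p} {r} (sameEdge {e} {x} {a} {b} {y} {c} {d}) =
      Bound-∣-∣ (extend r) (extend p) (∣extend-extend∣ e x a b y c d)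

    extend-≤-dist : ∀ {p r R} → DistLe N p r R → extend r ≤ extend p + R
    extend-≤-dist {p} (ℓ , path , ℓ≤R) = ≤-trans (≤-bound (path-bound path)) (+-monoʳ-≤ (extend p) ℓ≤R)

    private
      one-way : ∀ e → φ (tgt N e) ≡ φ (src N e) + len N e → φ (src N e) ≢ φ (tgt N e) + len N e
      one-way e up down = <-irrefl loop (x<x+p (φ (src N e)) (+-mono-< (len-pos N e) (len-pos N e)))
        where
        loop : φ (src N e) ≡ φ (src N e) + (len N e + len N e)
        loop = trans down (trans (cong (_+ len N e) up) (+-assoc (φ (src N e)) (len N e) (len N e)))

    extend-up : ∀ {e x a b} → φ (tgt N e) ≡ φ (src N e) + len N e → extend (inner e x a b) ≡ φ (src N e) + x
    extend-up {e} up with tight e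
    ... | inj₁ _ = refl
    ... | inj₂ down = contradiction down (one-way e up)

    extend-down : ∀ {e x a b} → φ (src N e) ≡ φ (tgt N e) + len N e → extend (inner e x a b) ≡ φ (src N e) - x
    extend-down {e} down with tight e
    ... | inj₁ up = contradiction down (one-way e up)
    ... | inj₂ _ = refl

module Walks (N : Network) where

  open import Data.Rational
  open import Data.Rational.Properties
  open import Relation.Binary.PropositionalEquality

  castWalk : ∀ {u u′ v v′ ℓ ℓ′} → u ≡ u′ → v ≡ v′ → ℓ ≡ ℓ′ → NWalk N u v ℓ → NWalk N u′ v′ ℓ′
  castWalk refl refl refl w = w

  _++ʷ_ : ∀ {u v w ℓ ℓ′} → NWalk N u v ℓ → NWalk N v w ℓ′ → NWalk N u w (ℓ + ℓ′)
  here _ ++ʷ w′ = castWalk refl refl (sym (+-identityˡ _)) w′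
  fwd e {ℓ = ℓ} w ++ʷ w′ = castWalk refl refl (sym (+-assoc (len N e) ℓ _)) (fwd e (w ++ʷ w′))
  bwd e {ℓ = ℓ} w ++ʷ w′ = castWalk refl refl (sym (+-assoc (len N e) ℓ _)) (bwd e (w ++ʷ w′))

  private
    swap-edge : ∀ ℓ L → ℓ + (L + 0ℚ) ≡ L + ℓ
    swap-edge ℓ L = trans (cong (ℓ +_) (+-identityʳ L)) (+-comm ℓ L)

  reverseʷ : ∀ {u v ℓ} → NWalk N u v ℓ → NWalk N v u ℓ
  reverseʷ (here u) = here u
  reverseʷ (fwd e {ℓ = ℓ} w) = castWalk refl refl (swap-edge ℓ (len N e)) (reverseʷ w ++ʷ bwd e (here _))
  reverseʷ (bwd e {ℓ = ℓ} w) = castWalk refl refl (swap-edge ℓ (len N e)) (reverseʷ w ++ʷ fwd e (here _))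

module Counting where

  open import Data.Nat using (ℕ; zero; suc; _+_; _<?_; z≤n; s≤s; s≤s⁻¹)
  open import Data.Fin using (Fin; zero; suc; toℕ; _↑ˡ_; _↑ʳ_)
  open import Data.Fin.Properties using (suc-injective) renaming (_≟_ to _≟ᶠ_)
  open import Data.List using (_∷_; _++_; length; filter; tabulate)
  open import Data.List.Properties using (filter-++; length-++; filter-none; filter-accept; filter-reject)
  open import Data.List.Relation.Unary.All.Properties using (tabulate⁺)
  open import Function using (_∘_; _⇔_; mk⇔; Equivalence)
  open import Level using (Level)
  open import Relation.Nullary using (¬_; Dec; yes; no; contradiction)
  open import Relation.Unary using (Pred; Decidable)
  open import Relation.Binary.PropositionalEquality

  private variable
    a p q : Level
    A B : Set a

  count : {P : Pred A p} → Decidable P → ∀ {n} → (Fin n → A) → ℕ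
  count P? f = length (filter P? (tabulate f))

  tabulate-↑ : ∀ m n (f : Fin (m + n) → A) → tabulate f ≡ tabulate (f ∘ (_↑ˡ n)) ++ tabulate (f ∘ (m ↑ʳ_))
  tabulate-↑ zero n f = refl
  tabulate-↑ (suc m) n f = cong (f zero ∷_) (tabulate-↑ m n (f ∘ suc))

  count-↑ : ∀ {P : Pred A p} (P? : Decidable P) m n (f : Fin (m + n) → A) →
    count P? f ≡ count P? (f ∘ (_↑ˡ n)) + count P? (f ∘ (m ↑ʳ_))
  count-↑ P? m n f = begin
    length (filter P? (tabulate f))                                                 ≡⟨ cong (length ∘ filter P?) (tabulate-↑ m n f) ⟩
    length (filter P? (tabulate (f ∘ (_↑ˡ n)) ++ tabulate (f ∘ (m ↑ʳ_))))             ≡⟨ cong length (filter-++ P? (tabulate (f ∘ (_↑ˡ n))) (tabulate (f ∘ (m ↑ʳ_)))) ⟩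
    length (filter P? (tabulate (f ∘ (_↑ˡ n))) ++ filter P? (tabulate (f ∘ (m ↑ʳ_)))) ≡⟨ length-++ (filter P? (tabulate (f ∘ (_↑ˡ n)))) ⟩
    count P? (f ∘ (_↑ˡ n)) + count P? (f ∘ (m ↑ʳ_))                                  ∎
    where open ≡-Reasoning

  count-none : ∀ {P : Pred A p} (P? : Decidable P) {n} (f : Fin n → A) → (∀ i → ¬ P (f i)) → count P? f ≡ 0
  count-none P? f none = cong length (filter-none P? (tabulate⁺ none))

  count-reject-head : ∀ {P : Pred A p} (P? : Decidable P) {n} (f : Fin (suc n) → A) → ¬ P (f zero) →
    count P? f ≡ count P? (f ∘ suc)
  count-reject-head P? f ¬P = cong length (filter-reject P? ¬P)

  count-accept-head : ∀ {P : Pred A p} (P? : Decidable P) {n} (f : Fin (suc n) → A) → P (f zero) →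
    count P? f ≡ suc (count P? (f ∘ suc))
  count-accept-head P? f Pf = cong length (filter-accept P? Pf)

  count-cong : ∀ {P : Pred A p} {Q : Pred B q} (P? : Decidable P) (Q? : Decidable Q) {n} (f : Fin n → A) (g : Fin n → B) →
    (∀ i → P (f i) ⇔ Q (g i)) → count P? f ≡ count Q? g
  count-cong P? Q? {zero} f g P⇔Q = refl
  count-cong {P = P} {Q = Q} P? Q? {suc n} f g P⇔Q = heads (P? (f zero)) (Q? (g zero))
    where
    tails : count P? (f ∘ suc) ≡ count Q? (g ∘ suc)
    tails = count-cong P? Q? (f ∘ suc) (g ∘ suc) (P⇔Q ∘ suc)
    heads : Dec (P (f zero)) → Dec (Q (g zero)) → count P? f ≡ count Q? g
    heads (yes Pf) (yes Qg) = trans (count-accept-head P? f Pf) (trans (cong suc tails) (sym (count-accept-head Q? g Qg)))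
    heads (no ¬Pf) (no ¬Qg) = trans (count-reject-head P? f ¬Pf) (trans tails (sym (count-reject-head Q? g ¬Qg)))
    heads (yes Pf) (no ¬Qg) = contradiction (Equivalence.to (P⇔Q zero) Pf) ¬Qg
    heads (no ¬Pf) (yes Qg) = contradiction (Equivalence.from (P⇔Q zero) Qg) ¬Pf

  count-≡ : ∀ {n} (i₀ : Fin n) → count (_≟ᶠ i₀) (λ i → i) ≡ 1
  count-≡ {suc n} zero = trans (count-accept-head (_≟ᶠ zero) {n} (λ i → i) refl) (cong suc (count-none (_≟ᶠ zero) {n} suc (λ i ())))
  count-≡ {suc n} (suc i₀) = trans (count-reject-head (_≟ᶠ suc i₀) {n} (λ i → i) (λ ()))
    (trans (count-cong (_≟ᶠ suc i₀) (_≟ᶠ i₀) {n} suc (λ i → i) (λ i → mk⇔ suc-injective (cong suc))) (count-≡ i₀))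

  count-unique : ∀ {P : Pred A p} (P? : Decidable P) {n} (f : Fin n → A) (i₀ : Fin n) →
    P (f i₀) → (∀ i → P (f i) → i ≡ i₀) → count P? f ≡ 1
  count-unique {P = P} P? f i₀ Pi₀ unique =
    trans (count-cong P? (_≟ᶠ i₀) f (λ i → i) (λ i → mk⇔ (unique i) λ { refl → Pi₀ })) (count-≡ i₀)

  count-< : ∀ t → count (λ (k : Fin (suc t)) → toℕ k <? t) (λ k → k) ≡ t
  count-< zero = refl
  count-< (suc t) = trans (count-accept-head (λ k → toℕ k <? suc t) {suc t} (λ k → k) (s≤s z≤n))
    (cong suc (trans (count-cong (λ k → toℕ k <? suc t) (λ k → toℕ k <? t) {suc t} suc (λ k → k) (λ k → mk⇔ s≤s⁻¹ s≤s)) (count-< t)))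

open import Data.Nat using (ℕ; suc; _+_; _^_; _≤_; _<_; _≤?_; s≤s⁻¹)
open import Data.Nat.Properties using (≤-trans; ≤-reflexive; +-comm; ≰⇒>)
open import Data.Nat.Logarithm using (⌈log₂_⌉; ⌈log₂⌉-mono-≤; ⌈log₂2^n⌉≡n)
open import Data.Empty using (⊥-elim)
open import Relation.Nullary using (yes; no)
open import Relation.Binary.PropositionalEquality using (subst)

-- Spine nodes 0 … t + 1 sit at positions x 0 < x 1 < …; each carries a pendant leg of length L.
module Caterpillar (t : ℕ) (x : ℕ → ℕ) (x-strictMono : ∀ {i j} → i < j → x i < x j) (L : ℕ) (0<L : 0 < L) where

  open import Data.Nat using (zero; _+_; _∸_; _≤_; ∣_-_∣; _<?_; z≤n; s≤s; s≤s⁻¹)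
  import Data.Nat.Properties as ℕ
  open import Data.Fin using (Fin; zero; suc; toℕ; inject₁; fromℕ<; _↑ˡ_; _↑ʳ_; splitAt)
  open import Data.Fin.Properties
    using (toℕ-↑ˡ; toℕ-↑ʳ; ↑ˡ-injective; ↑ʳ-injective; toℕ<n; toℕ-injective; toℕ-inject₁; toℕ-fromℕ<;
           splitAt-↑ˡ; splitAt-↑ʳ; splitAt⁻¹-↑ˡ; splitAt⁻¹-↑ʳ; suc-injective; inject₁-injective; 0≢1+n)
    renaming (_≟_ to _≟ᶠ_)
  open import Data.Rational as ℚ using (ℚ)
  open import Data.Sum using (_⊎_; inj₁; inj₂; [_,_]′)
  open import Data.Product using (∃; _,_; proj₂)
  open import Data.Fin.Induction using (<-weakInduction)
  open import Relation.Binary.PropositionalEquality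
  open import Relation.Nullary using (¬_; Dec; yes; no; contradiction)
  open import Function using (_∘_; _⇔_; mk⇔)
  open Arithmetic using (∸-telescope)
  open Rationals

  M : ℕ
  M = suc (suc t)

  spine leaf : Fin M → Fin (M + M)
  spine k = k ↑ˡ M
  leaf k = M ↑ʳ k

  spineEdge : Fin (suc t) → Fin (suc t + M)
  spineEdge j = j ↑ˡ M

  leg : Fin M → Fin (suc t + M)
  leg k = suc t ↑ʳ k

  gapAfter : ℕ → ℕ
  gapAfter i = x (suc i) ∸ x i

  private
    src⊎ tgt⊎ : Fin (suc t) ⊎ Fin M → Fin (M + M)
    src⊎ (inj₁ j) = spine (inject₁ j)
    src⊎ (inj₂ k) = spine k
    tgt⊎ (inj₁ j) = spine (suc j)
    tgt⊎ (inj₂ k) = leaf k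

    length⊎ : Fin (suc t) ⊎ Fin M → ℕ
    length⊎ (inj₁ j) = gapAfter (toℕ j)
    length⊎ (inj₂ k) = L

  spine-injective : ∀ {i j} → spine i ≡ spine j → i ≡ j
  spine-injective {i} {j} = ↑ˡ-injective M i j

  spine≢leaf : ∀ i j → spine i ≢ leaf j
  spine≢leaf i j eq = ℕ.<⇒≱ (toℕ<n i) (begin
    M                  ≤⟨ ℕ.m≤m+n M (toℕ j) ⟩
    M + toℕ j          ≡⟨ toℕ-↑ʳ M j ⟨
    toℕ (leaf j)       ≡⟨ cong toℕ eq ⟨
    toℕ (spine i)      ≡⟨ toℕ-↑ˡ i M ⟩
    toℕ i              ∎)
    where open ℕ.≤-Reasoning

  private
    noloop⊎ : ∀ s → src⊎ s ≢ tgt⊎ s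
    noloop⊎ (inj₁ j) eq = ℕ.1+n≢n (sym (trans (sym (toℕ-inject₁ j)) (cong toℕ (spine-injective eq))))
    noloop⊎ (inj₂ k) = spine≢leaf k k

    length⊎-pos : ∀ s → 0 < length⊎ s
    length⊎-pos (inj₁ j) = ℕ.m<n⇒0<n∸m (x-strictMono (ℕ.n<1+n (toℕ j)))
    length⊎-pos (inj₂ k) = 0<L

  edgeLength : Fin (suc t + M) → ℕ
  edgeLength e = length⊎ (splitAt (suc t) e)

  caterpillar : Network
  caterpillar = record
    { m = M + M ; E = suc t + M
    ; src = λ e → src⊎ (splitAt (suc t) e) ; tgt = λ e → tgt⊎ (splitAt (suc t) e)
    ; noloop = λ e → noloop⊎ (splitAt (suc t) e)
    ; len = λ e → toℚ (edgeLength e) ; len-pos = λ e → toℚ-strictMono (length⊎-pos (splitAt (suc t) e)) }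

  module _ (j : Fin (suc t)) where
    src-spineEdge : src caterpillar (spineEdge j) ≡ spine (inject₁ j)
    src-spineEdge = cong src⊎ (splitAt-↑ˡ (suc t) j M)
    tgt-spineEdge : tgt caterpillar (spineEdge j) ≡ spine (suc j)
    tgt-spineEdge = cong tgt⊎ (splitAt-↑ˡ (suc t) j M)
    length-spineEdge : edgeLength (spineEdge j) ≡ gapAfter (toℕ j)
    length-spineEdge = cong length⊎ (splitAt-↑ˡ (suc t) j M)

  module _ (k : Fin M) where
    src-leg : src caterpillar (leg k) ≡ spine k
    src-leg = cong src⊎ (splitAt-↑ʳ (suc t) M k)
    tgt-leg : tgt caterpillar (leg k) ≡ leaf k
    tgt-leg = cong tgt⊎ (splitAt-↑ʳ (suc t) M k)
    length-leg : edgeLength (leg k) ≡ L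
    length-leg = cong length⊎ (splitAt-↑ʳ (suc t) M k)

  edge-cases : (P : Fin (suc t + M) → Set) → (∀ j → P (spineEdge j)) → (∀ k → P (leg k)) → ∀ e → P e
  edge-cases P spineCase legCase e with splitAt (suc t) e in eq
  ... | inj₁ j = subst P (splitAt⁻¹-↑ˡ eq) (spineCase j)
  ... | inj₂ k = subst P (splitAt⁻¹-↑ʳ eq) (legCase k)

  node-cases : (P : Fin (M + M) → Set) → (∀ k → P (spine k)) → (∀ k → P (leaf k)) → ∀ v → P v
  node-cases P spineCase leafCase v with splitAt M v in eq
  ... | inj₁ k = subst P (splitAt⁻¹-↑ˡ eq) (spineCase k)
  ... | inj₂ k = subst P (splitAt⁻¹-↑ʳ eq) (leafCase k)

  onNodes : (Fin M → ℕ) → (Fin M → ℕ) → Fin (M + M) → ℕ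
  onNodes f g v = [ f , g ]′ (splitAt M v)

  onNodes-spine : ∀ f g k → onNodes f g (spine k) ≡ f k
  onNodes-spine f g k = cong [ f , g ]′ (splitAt-↑ˡ M k M)

  onNodes-leaf : ∀ f g k → onNodes f g (leaf k) ≡ g k
  onNodes-leaf f g k = cong [ f , g ]′ (splitAt-↑ʳ M M k)

  open Counting
  open Walks caterpillar

  private
    N : Network
    N = caterpillar

    srcAt : (v : Fin (M + M)) (e : Fin (suc t + M)) → Dec (src N e ≡ v)
    srcAt v e = src N e ≟ᶠ v

    tgtAt : (v : Fin (M + M)) (e : Fin (suc t + M)) → Dec (tgt N e ≡ v)
    tgtAt v e = tgt N e ≟ᶠ v

  degree-split : ∀ v → degree N v ≡
    (count (srcAt v) spineEdge + count (srcAt v) leg) + (count (tgtAt v) spineEdge + count (tgtAt v) leg)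
  degree-split v = cong₂ _+_ (count-↑ (srcAt v) (suc t) M (λ e → e)) (count-↑ (tgtAt v) (suc t) M (λ e → e))

  degree-leaf : ∀ k → degree N (leaf k) ≡ 1
  degree-leaf k = trans (degree-split (leaf k)) (cong₂ _+_
    (cong₂ _+_ (count-none (srcAt (leaf k)) spineEdge λ j eq → spine≢leaf _ k (trans (sym (src-spineEdge j)) eq))
               (count-none (srcAt (leaf k)) leg λ j eq → spine≢leaf j k (trans (sym (src-leg j)) eq)))
    (cong₂ _+_ (count-none (tgtAt (leaf k)) spineEdge λ j eq → spine≢leaf _ k (trans (sym (tgt-spineEdge j)) eq))
               (count-unique (tgtAt (leaf k)) leg k (tgt-leg k) λ j eq → ↑ʳ-injective M j k (trans (sym (tgt-leg j)) eq))))

  degree-spine-zero : degree N (spine zero) ≡ 2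
  degree-spine-zero = trans (degree-split (spine zero)) (cong₂ _+_
    (cong₂ _+_ (count-unique (srcAt (spine zero)) spineEdge zero (src-spineEdge zero)
                  λ j eq → inject₁-injective (spine-injective (trans (sym (src-spineEdge j)) eq)))
               (count-unique (srcAt (spine zero)) leg zero (src-leg zero) λ j eq → spine-injective (trans (sym (src-leg j)) eq)))
    (cong₂ _+_ (count-none (tgtAt (spine zero)) spineEdge λ j eq → 0≢1+n (sym (spine-injective (trans (sym (tgt-spineEdge j)) eq))))
               (count-none (tgtAt (spine zero)) leg λ j eq → spine≢leaf zero j (sym (trans (sym (tgt-leg j)) eq)))))

  degree-spine-suc : ∀ k → degree N (spine (suc k)) ≡ (count (srcAt (spine (suc k))) spineEdge + 1) + (1 + 0)
  degree-spine-suc k = trans (degree-split (spine (suc k))) (cong₂ _+_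
    (cong (count (srcAt (spine (suc k))) spineEdge +_)
      (count-unique (srcAt (spine (suc k))) leg (suc k) (src-leg (suc k)) λ j eq → spine-injective (trans (sym (src-leg j)) eq)))
    (cong₂ _+_ (count-unique (tgtAt (spine (suc k))) spineEdge k (tgt-spineEdge k)
                  λ j eq → suc-injective (spine-injective (trans (sym (tgt-spineEdge j)) eq)))
               (count-none (tgtAt (spine (suc k))) leg λ j eq → spine≢leaf (suc k) j (sym (trans (sym (tgt-leg j)) eq)))))

  private
    inject₁-toℕ : ∀ {j : Fin (suc t)} {i} → inject₁ j ≡ i → toℕ j ≡ toℕ i
    inject₁-toℕ {j} eq = trans (sym (toℕ-inject₁ j)) (cong toℕ eq)

    srcAt-spineEdge : ∀ {v j} → src N (spineEdge j) ≡ spine v → toℕ j ≡ toℕ v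
    srcAt-spineEdge {j = j} eq = inject₁-toℕ (spine-injective (trans (sym (src-spineEdge j)) eq))

  spine-out-< : ∀ k → toℕ k < t → count (srcAt (spine (suc k))) spineEdge ≡ 1
  spine-out-< k k<t = count-unique (srcAt (spine (suc k))) spineEdge j₀
    (trans (src-spineEdge j₀) (cong spine (toℕ-injective (trans (toℕ-inject₁ j₀) toℕ-j₀))))
    λ j eq → toℕ-injective (trans (srcAt-spineEdge eq) (sym toℕ-j₀))
    where
    j₀ : Fin (suc t)
    j₀ = fromℕ< (s≤s k<t)
    toℕ-j₀ : toℕ j₀ ≡ suc (toℕ k)
    toℕ-j₀ = toℕ-fromℕ< (s≤s k<t)

  spine-out-≮ : ∀ k → ¬ toℕ k < t → count (srcAt (spine (suc k))) spineEdge ≡ 0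
  spine-out-≮ k k≮t = count-none (srcAt (spine (suc k))) spineEdge
    λ j eq → k≮t (s≤s⁻¹ (subst (_< suc t) (srcAt-spineEdge eq) (toℕ<n j)))

  internal-spine-suc : ∀ k → 3 ≤ degree N (spine (suc k)) ⇔ toℕ k < t
  internal-spine-suc k = mk⇔ to from
    where
    degree≡ : ∀ {s} → count (srcAt (spine (suc k))) spineEdge ≡ s → degree N (spine (suc k)) ≡ (s + 1) + (1 + 0)
    degree≡ eq = trans (degree-spine-suc k) (cong (λ s → (s + 1) + (1 + 0)) eq)
    from : toℕ k < t → 3 ≤ degree N (spine (suc k))
    from k<t = ℕ.≤-reflexive (sym (degree≡ (spine-out-< k k<t)))
    to : 3 ≤ degree N (spine (suc k)) → toℕ k < t
    to 3≤deg with toℕ k <? t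
    ... | yes k<t = k<t
    ... | no k≮t = contradiction (subst (3 ≤_) (degree≡ (spine-out-≮ k k≮t)) 3≤deg) λ { (s≤s (s≤s ())) }

  caterpillar-internalNodes : internalNodes N ≡ t
  caterpillar-internalNodes = begin
    internalNodes N                                          ≡⟨ count-↑ internal? M M (λ v → v) ⟩
    count internal? spine + count internal? leaf             ≡⟨ cong₂ _+_ spines leaves ⟩
    t + 0                                                    ≡⟨ ℕ.+-identityʳ t ⟩
    t                                                        ∎
    where
    open ≡-Reasoning
    internal? : ∀ v → Dec (3 ≤ degree N v)
    internal? v = 3 ℕ.≤? degree N v
    leaves : count internal? leaf ≡ 0
    leaves = count-none internal? leaf λ k 3≤deg → contradiction (subst (3 ≤_) (degree-leaf k) 3≤deg) λ { (s≤s ()) }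
    spine-zero-external : ¬ 3 ≤ degree N (spine zero)
    spine-zero-external 3≤deg = contradiction (subst (3 ≤_) degree-spine-zero 3≤deg) λ { (s≤s (s≤s ())) }
    spines : count internal? spine ≡ t
    spines = begin
      count internal? spine                                  ≡⟨ count-reject-head internal? spine spine-zero-external ⟩
      count internal? (spine ∘ suc)                          ≡⟨ count-cong internal? (λ k → toℕ k <? t) (spine ∘ suc) (λ k → k) internal-spine-suc ⟩
      count (λ (k : Fin (suc t)) → toℕ k <? t) (λ k → k)     ≡⟨ count-< t ⟩
      t                                                      ∎

  x-mono-≤ : ∀ {i j} → i ≤ j → x i ≤ x j
  x-mono-≤ i≤j with ℕ.m≤n⇒m<n∨m≡n i≤j
  ... | inj₁ i<j = ℕ.<⇒≤ (x-strictMono i<j)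
  ... | inj₂ refl = ℕ.≤-refl

  private
    stay : ∀ k → NWalk N (spine k) (spine k) (toℚ (x (toℕ k) ∸ x (toℕ k)))
    stay k = castWalk refl refl (cong toℚ (sym (ℕ.n∸n≡0 (x (toℕ k))))) (here (spine k))

    down-step : ∀ {i} j → toℕ i ≤ toℕ j →
      NWalk N (spine (inject₁ j)) (spine i) (toℚ (x (toℕ (inject₁ j)) ∸ x (toℕ i))) →
      NWalk N (spine (suc j)) (spine i) (toℚ (x (suc (toℕ j)) ∸ x (toℕ i)))
    down-step {i} j i≤j w = castWalk (tgt-spineEdge j) refl length
      (bwd (spineEdge j) (castWalk (sym (src-spineEdge j)) refl refl w))
      where
      length : len N (spineEdge j) ℚ.+ toℚ (x (toℕ (inject₁ j)) ∸ x (toℕ i)) ≡ toℚ (x (suc (toℕ j)) ∸ x (toℕ i))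
      length rewrite length-spineEdge j | toℕ-inject₁ j =
        trans (sym (toℚ-+ (gapAfter (toℕ j)) _)) (cong toℚ (∸-telescope (x-mono-≤ i≤j) (x-mono-≤ (ℕ.n≤1+n (toℕ j)))))

  spine-descent : ∀ {i} j → toℕ i ≤ toℕ j → NWalk N (spine j) (spine i) (toℚ (x (toℕ j) ∸ x (toℕ i)))
  spine-descent {i} = <-weakInduction Descent base step
    where
    Descent : Fin M → Set
    Descent j = toℕ i ≤ toℕ j → NWalk N (spine j) (spine i) (toℚ (x (toℕ j) ∸ x (toℕ i)))
    base : Descent zero
    base i≤0 rewrite toℕ-injective {i = i} {zero} (ℕ.n≤0⇒n≡0 i≤0) = stay zero
    step : ∀ j → Descent (inject₁ j) → Descent (suc j)
    step j descent i≤1+j with ℕ.m≤n⇒m<n∨m≡n i≤1+j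
    ... | inj₁ i<1+j = down-step j (s≤s⁻¹ i<1+j) (descent (subst (toℕ i ≤_) (sym (toℕ-inject₁ j)) (s≤s⁻¹ i<1+j)))
    ... | inj₂ i≡1+j rewrite toℕ-injective {i = i} {suc j} i≡1+j = stay (suc j)

  spine-walk : ∀ i j → NWalk N (spine i) (spine j) (toℚ ∣ x (toℕ i) - x (toℕ j) ∣)
  spine-walk i j with ℕ.≤-total (toℕ i) (toℕ j)
  ... | inj₁ i≤j = castWalk refl refl (cong toℚ (sym (ℕ.m≤n⇒∣m-n∣≡n∸m (x-mono-≤ i≤j)))) (reverseʷ (spine-descent j i≤j))
  ... | inj₂ j≤i = castWalk refl refl (cong toℚ (sym (ℕ.m≤n⇒∣n-m∣≡n∸m (x-mono-≤ j≤i)))) (spine-descent i j≤i)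

  private
    toRoot : ∀ v → ∃ λ ℓ → NWalk N v (spine zero) ℓ
    toRoot = node-cases (λ v → ∃ λ ℓ → NWalk N v (spine zero) ℓ)
      (λ k → _ , spine-descent k z≤n)
      (λ k → _ , castWalk (tgt-leg k) refl refl (bwd (leg k) (castWalk (sym (src-leg k)) refl refl (spine-descent k z≤n))))

  caterpillar-tree : IsTree N
  caterpillar-tree = refl , λ u v → _ , proj₂ (toRoot u) ++ʷ reverseʷ (proj₂ (toRoot v))

  open Potential using (TightOn; Tight)

  SpineTight : (Fin M → ℕ) → Set
  SpineTight f = ∀ j → f (suc j) ≡ f (inject₁ j) + gapAfter (toℕ j) ⊎ f (inject₁ j) ≡ f (suc j) + gapAfter (toℕ j)

  LegTight : (Fin M → ℕ) → (Fin M → ℕ) → Set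
  LegTight f g = ∀ k → g k ≡ f k + L ⊎ f k ≡ g k + L

  Tight-onNodes : ∀ f g → SpineTight f → LegTight f g → Tight N (toℚ ∘ onNodes f g)
  Tight-onNodes f g spineTight legTight = edge-cases (TightOn N (toℚ ∘ onNodes f g)) spineCase legCase
    where
    toℚ-tight : ∀ {a b c} → a ≡ b + c ⊎ b ≡ a + c → toℚ a ≡ toℚ b ℚ.+ toℚ c ⊎ toℚ b ≡ toℚ a ℚ.+ toℚ c
    toℚ-tight {a} {b} {c} (inj₁ eq) = inj₁ (trans (cong toℚ eq) (toℚ-+ b c))
    toℚ-tight {a} {b} {c} (inj₂ eq) = inj₂ (trans (cong toℚ eq) (toℚ-+ a c))
    spineCase : ∀ j → TightOn N (toℚ ∘ onNodes f g) (spineEdge j)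
    spineCase j rewrite src-spineEdge j | tgt-spineEdge j | length-spineEdge j
      | onNodes-spine f g (inject₁ j) | onNodes-spine f g (suc j) = toℚ-tight (spineTight j)
    legCase : ∀ k → TightOn N (toℚ ∘ onNodes f g) (leg k)
    legCase k rewrite src-leg k | tgt-leg k | length-leg k
      | onNodes-spine f g k | onNodes-leaf f g k = toℚ-tight (legTight k)

  toℚ<leg : ∀ k {y} → y < L → toℚ y ℚ.< len N (leg k)
  toℚ<leg k {y} y<L = subst (λ ℓ → toℚ y ℚ.< toℚ ℓ) (sym (length-leg k)) (toℚ-strictMono y<L)

  onLeg : (k : Fin M) (y : ℕ) → 0 < y → y < L → Point N
  onLeg k y 0<y y<L = inner (leg k) (toℚ y) (toℚ-strictMono 0<y) (toℚ<leg k y<L)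

  module OnNodesExtension (f g : Fin M → ℕ) (spineTight : SpineTight f) (legTight : LegTight f g) where

    open Potential.Extension N (toℚ ∘ onNodes f g) (Tight-onNodes f g spineTight legTight) public

    private
      φ-src-leg : ∀ k → toℚ (onNodes f g (src N (leg k))) ≡ toℚ (f k)
      φ-src-leg k = cong toℚ (trans (cong (onNodes f g) (src-leg k)) (onNodes-spine f g k))

    extend-spine : ∀ k → extend (node (spine k)) ≡ toℚ (f k)
    extend-spine k = cong toℚ (onNodes-spine f g k)

    extend-leaf : ∀ k → extend (node (leaf k)) ≡ toℚ (g k)
    extend-leaf k = cong toℚ (onNodes-leaf f g k)

    extend-onLeg-up : ∀ {k y 0<y y<L} → g k ≡ f k + L → extend (onLeg k y 0<y y<L) ≡ toℚ (f k) ℚ.+ toℚ y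
    extend-onLeg-up {k} {y} {0<y} {y<L} up =
      trans (extend-up {leg k} {toℚ y} {toℚ-strictMono 0<y} {toℚ<leg k y<L} tgt≡src+L) (cong (ℚ._+ toℚ y) (φ-src-leg k))
      where
      tgt≡src+L : toℚ (onNodes f g (tgt N (leg k))) ≡ toℚ (onNodes f g (src N (leg k))) ℚ.+ toℚ (edgeLength (leg k))
      tgt≡src+L rewrite src-leg k | tgt-leg k | length-leg k | onNodes-spine f g k | onNodes-leaf f g k =
        trans (cong toℚ up) (toℚ-+ (f k) L)

    extend-onLeg-down : ∀ {k y 0<y y<L} → f k ≡ g k + L → extend (onLeg k y 0<y y<L) ≡ toℚ (f k) ℚ.- toℚ y
    extend-onLeg-down {k} {y} {0<y} {y<L} down =
      trans (extend-down {leg k} {toℚ y} {toℚ-strictMono 0<y} {toℚ<leg k y<L} src≡tgt+L) (cong (ℚ._- toℚ y) (φ-src-leg k))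
      where
      src≡tgt+L : toℚ (onNodes f g (src N (leg k))) ≡ toℚ (onNodes f g (tgt N (leg k))) ℚ.+ toℚ (edgeLength (leg k))
      src≡tgt+L rewrite src-leg k | tgt-leg k | length-leg k | onNodes-spine f g k | onNodes-leaf f g k =
        trans (cong toℚ down) (toℚ-+ (g k) L)

module Colourings where

  open import Data.Nat using (_+_; _<_; _<?_; _≤_)
  open import Data.Nat.Properties using (<-≤-trans; m<m+n)
  open import Data.Fin using (Fin; toℕ; fromℕ<)
  open import Data.Fin.Properties using (toℕ-fromℕ<; fromℕ<-toℕ; toℕ<n)
  open import Data.Product using (_×_; _,_; proj₁; proj₂)
  open import Relation.Nullary using (yes; no; contradiction)
  open import Relation.Binary.PropositionalEquality
  open DyadicBlocks

  -- Indices ≥ n get the junk colour default.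
  extendColouring : ∀ {n k} → (Fin n → Fin k) → Fin k → ℕ → Fin k
  extendColouring {n} col default j with j <? n
  ... | yes j<n = col (fromℕ< j<n)
  ... | no _ = default

  extendColouring-toℕ : ∀ {n k} (col : Fin n → Fin k) default i → extendColouring col default (toℕ i) ≡ col i
  extendColouring-toℕ {n} col default i with toℕ i <? n
  ... | yes i<n = cong col (fromℕ<-toℕ i i<n)
  ... | no i≮n = contradiction (toℕ<n i) i≮n

  ConflictFree⇒HasUniqueColour : ∀ {N n k} {B : Fin n → Ball N} {col : Fin n → Fin k} (default : Fin k) →
    ConflictFree B col → ∀ p {o w} → o + w ≤ n → 0 < w →
    (∀ i → (p ∈B B i → InRange o w (toℕ i)) × (InRange o w (toℕ i) → p ∈B B i)) →
    HasUniqueColour (extendColouring col default) o w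
  ConflictFree⇒HasUniqueColour {n = n} {col = col} default cf p {o} {w} o+w≤n 0<w balls∋p
    with cf p (fromℕ< o<n , proj₂ (balls∋p (fromℕ< o<n)) (subst (InRange o w) (sym (toℕ-fromℕ< o<n)) (InRange-start o 0<w)))
    where
    o<n : o < n
    o<n = <-≤-trans (m<m+n o 0<w) o+w≤n
  ... | i , p∈Bi , unique = toℕ i , proj₁ (balls∋p i) p∈Bi , colour-differs
    where
    colour-differs : ∀ j → InRange o w j → j ≢ toℕ i → extendColouring col default j ≢ extendColouring col default (toℕ i)
    colour-differs j j∈ j≢i same-colour = unique jf (λ jf≡i → j≢i (trans (sym toℕ-jf) (cong toℕ jf≡i)))
      (proj₂ (balls∋p jf) (subst (InRange o w) (sym toℕ-jf) j∈))
      (trans (sym colour-jf) (trans same-colour (extendColouring-toℕ col default i)))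
      where
      j<n : j < n
      j<n = <-≤-trans (proj₂ j∈) o+w≤n
      jf : Fin n
      jf = fromℕ< j<n
      toℕ-jf : toℕ jf ≡ j
      toℕ-jf = toℕ-fromℕ< j<n
      colour-jf : extendColouring col default j ≡ col jf
      colour-jf = trans (cong (extendColouring col default) (sym toℕ-jf)) (extendColouring-toℕ col default jf)

module LowerBound (t c n : ℕ) (2^c≤t : 2 ^ c ≤ t) (t<n : t < n) where

  open import Data.Nat using (_∸_; ∣_-_∣; _<?_; z≤n; s≤s)
  open import Data.Nat.Properties as ℕ using ()
  open import Data.Fin using (Fin; suc; toℕ; fromℕ; fromℕ<; inject₁)
  open import Data.Fin.Properties using (toℕ-fromℕ; toℕ-fromℕ<; toℕ-inject₁; toℕ<n; toℕ-injective)
  open import Relation.Binary.Definitions using (tri<; tri≈; tri>)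
  open import Data.Rational as ℚ using (ℚ; 0ℚ)
  import Data.Rational.Properties as ℚ
  open import Data.Product using (_×_; _,_; proj₁; proj₂)
  open import Data.Sum using (inj₁; inj₂)
  open import Function using (_∘_)
  open import Relation.Nullary using (¬_; Dec; yes; no; contradiction)
  open import Relation.Binary.PropositionalEquality
  open DyadicBlocks
  open Layout
  open Arithmetic
  open Rationals

  X : ℕ → ℕ
  X = pos c

  K R L : ℕ
  K = 2 ^ c
  R = suc (ρ c)
  L = suc (R + n)

  open Caterpillar t X (pos-strictMono c) L (s≤s z≤n)
  open Walks caterpillar using (castWalk)

  T : ℕ
  T = X (suc t)

  last : Fin M
  last = fromℕ (suc t)

  ascending descending : Fin M → ℕ
  ascending k = X (toℕ k)
  descending k = T ∸ X (toℕ k)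

  ascending-step : ∀ j → ascending (suc j) ≡ ascending (inject₁ j) + gapAfter (toℕ j)
  ascending-step j rewrite toℕ-inject₁ j = sym (ℕ.m+[n∸m]≡n (x-mono-≤ (ℕ.n≤1+n (toℕ j))))

  descending-step : ∀ j → descending (inject₁ j) ≡ descending (suc j) + gapAfter (toℕ j)
  descending-step j rewrite toℕ-inject₁ j =
    sym (∸-telescope (x-mono-≤ (ℕ.n≤1+n (toℕ j))) (x-mono-≤ (toℕ<n j)))

  -- Up and Down bound distances along the spine from either side; Far decreases towards the far leaf.
  module Up = OnNodesExtension ascending (λ k → ascending k + L) (inj₁ ∘ ascending-step) (λ _ → inj₁ refl)
  module Down = OnNodesExtension descending (λ k → descending k + L) (inj₂ ∘ descending-step) (λ _ → inj₁ refl)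
  module Far = OnNodesExtension (λ k → descending k + L) descending
    (λ j → inj₂ (trans (cong (_+ L) (descending-step j)) (+-rightComm (descending (suc j)) (gapAfter (toℕ j)) L)))
    (λ _ → inj₂ refl)

  <K⇒<M : ∀ {x} → x < K → x < M
  <K⇒<M x<K = ℕ.≤-trans x<K (ℕ.≤-trans 2^c≤t (ℕ.≤-trans (ℕ.n≤1+n t) (ℕ.n≤1+n (suc t))))

  spineAt : ∀ x → x < K → Fin M
  spineAt x x<K = fromℕ< (<K⇒<M x<K)

  toℕ-spineAt : ∀ x (x<K : x < K) → toℕ (spineAt x x<K) ≡ x
  toℕ-spineAt x x<K = toℕ-fromℕ< (<K⇒<M x<K)

  mainBall : ∀ x → x < K → Ball caterpillar
  mainBall x x<K = ball (node (spine (spineAt x x<K))) (toℚ R) (toℚ-pos (ρ c))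

  extraBall : ℕ → Ball caterpillar
  extraBall r = ball (node (leaf last)) (toℚ (suc r)) (toℚ-pos r)

  extra<n : ∀ (i : Fin n) → toℕ i ∸ K < n
  extra<n i = ℕ.≤-<-trans (ℕ.m∸n≤m (toℕ i) K) (toℕ<n i)

  balls : Fin n → Ball caterpillar
  balls i with toℕ i <? K
  ... | yes i<K = mainBall (toℕ i) i<K
  ... | no _ = extraBall (toℕ i ∸ K)

  height : ℕ → ℕ
  height b = suc (ρ c ∸ ρ b)

  height≤R : ∀ b → height b ≤ R
  height≤R b = s≤s (ℕ.m∸n≤m (ρ c) (ρ b))

  height<L : ∀ b → height b < L
  height<L b = s≤s (ℕ.≤-trans (height≤R b) (ℕ.m≤m+n R n))

  n<L∸height : ∀ b → n < L ∸ height b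
  n<L∸height b = ℕ.m+n≤o⇒m≤o∸n (suc n) (s≤s (subst (n + height b ≤_) (ℕ.+-comm n R) (ℕ.+-monoʳ-≤ n (height≤R b))))

  ρ+height : ∀ {b} → b ≤ c → ρ b + height b ≡ R
  ρ+height {b} b≤c = trans (ℕ.+-suc (ρ b) (ρ c ∸ ρ b)) (cong suc (ℕ.m+[n∸m]≡n (ρ-mono b≤c)))

  -- At height R ∸ ρ b above spine node o, within distance R of exactly the spine nodes that are within ρ b of o.
  witness : ∀ b o → o < K → Point caterpillar
  witness b o o<K = onLeg (spineAt o o<K) (height b) (s≤s z≤n) (height<L b)

  0<L∸suc : ∀ {r} → r < n → 0 < L ∸ suc r
  0<L∸suc r<n = ℕ.m<n⇒0<n∸m (ℕ.<-≤-trans r<n (ℕ.m≤n+m n R))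

  L∸suc<L : ∀ r → L ∸ suc r < L
  L∸suc<L r = s≤s (ℕ.m∸n≤m (R + n) r)

  farPoint : ∀ r → r < n → Point caterpillar
  farPoint r r<n = onLeg last (L ∸ suc r) (0<L∸suc r<n) (L∸suc<L r)

  private
    X≤T : ∀ {x} → x < K → X x ≤ T
    X≤T x<K = x-mono-≤ (ℕ.m<1+n⇒m≤n (<K⇒<M x<K))

  module _ (b : ℕ) {o : ℕ} (o<K : o < K) where
    witness-up : Up.extend (witness b o o<K) ≡ toℚ (X o) ℚ.+ toℚ (height b)
    witness-up = trans (Up.extend-onLeg-up {spineAt o o<K} {height b} {s≤s z≤n} {height<L b} refl)
      (cong (λ i → toℚ (X i) ℚ.+ toℚ (height b)) (toℕ-spineAt o o<K))

    witness-down : Down.extend (witness b o o<K) ≡ toℚ (T ∸ X o) ℚ.+ toℚ (height b)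
    witness-down = trans (Down.extend-onLeg-up {spineAt o o<K} {height b} {s≤s z≤n} {height<L b} refl)
      (cong (λ i → toℚ (T ∸ X i) ℚ.+ toℚ (height b)) (toℕ-spineAt o o<K))

    witness-far : Far.extend (witness b o o<K) ≡ toℚ (T ∸ X o + L) ℚ.- toℚ (height b)
    witness-far = trans (Far.extend-onLeg-down {spineAt o o<K} {height b} {s≤s z≤n} {height<L b} refl)
      (cong (λ i → toℚ (T ∸ X i + L) ℚ.- toℚ (height b)) (toℕ-spineAt o o<K))

  module _ {x : ℕ} (x<K : x < K) where
    spineAt-up : Up.extend (node (spine (spineAt x x<K))) ≡ toℚ (X x)
    spineAt-up = trans (Up.extend-spine (spineAt x x<K)) (cong (toℚ ∘ X) (toℕ-spineAt x x<K))

    spineAt-down : Down.extend (node (spine (spineAt x x<K))) ≡ toℚ (T ∸ X x)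
    spineAt-down = trans (Down.extend-spine (spineAt x x<K)) (cong (λ i → toℚ (T ∸ X i)) (toℕ-spineAt x x<K))

  witness-near : ∀ {b o x} (o<K : o < K) (x<K : x < K) → b ≤ c →
    witness b o o<K ∈B mainBall x x<K → ∣ X x - X o ∣ ≤ ρ b
  witness-near {b} {o} {x} o<K x<K b≤c d = m≤n+o⇒n≤m+o⇒∣m-n∣≤o
    (m+h≤n+[o+h]⇒m≤n+o (X x) (X o) (ρ b) (height b) (subst (λ r → X x + height b ≤ X o + r) R≡ down))
    (m+h≤n+[o+h]⇒m≤n+o (X o) (X x) (ρ b) (height b) (subst (λ r → X o + height b ≤ X x + r) R≡ up))
    where
    R≡ : R ≡ ρ b + height b
    R≡ = sym (ρ+height b≤c)
    up : X o + height b ≤ X x + R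
    up = toℚ-cancel-+-≤ (X o) (height b) (X x) R
      (subst₂ ℚ._≤_ (witness-up b o<K) (cong (ℚ._+ toℚ R) (spineAt-up x<K)) (Up.extend-≤-dist d))
    down : X x + height b ≤ X o + R
    down = ∸-flip (X≤T o<K) (X≤T x<K) (toℚ-cancel-+-≤ (T ∸ X o) (height b) (T ∸ X x) R
      (subst₂ ℚ._≤_ (witness-down b o<K) (cong (ℚ._+ toℚ R) (spineAt-down x<K)) (Down.extend-≤-dist d)))

  witness-in-main : ∀ {b o x} → Dyadic c b o → (o<K : o < K) (x<K : x < K) →
    InRange o (2 ^ b) x → witness b o o<K ∈B mainBall x x<K
  witness-in-main {b} {o} {x} d o<K x<K x∈ =
    _ , enterSrc (fromNode (castWalk refl (sym (src-leg ko)) refl (spine-walk kx ko))) , length≤R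
    where
    ko kx : Fin M
    ko = spineAt o o<K
    kx = spineAt x x<K
    near : ∣ X (toℕ kx) - X (toℕ ko) ∣ + height b ≤ R
    near rewrite toℕ-spineAt x x<K | toℕ-spineAt o o<K =
      ℕ.≤-trans (ℕ.+-monoˡ-≤ (height b) (pos-near d x∈)) (ℕ.≤-reflexive (ρ+height (Dyadic-level≤ d)))
    length≤R : toℚ ∣ X (toℕ kx) - X (toℕ ko) ∣ ℚ.+ toℚ (height b) ℚ.≤ toℚ R
    length≤R = subst (ℚ._≤ toℚ R) (toℚ-+ ∣ X (toℕ kx) - X (toℕ ko) ∣ (height b)) (toℚ-mono-≤ near)

  descending-last : descending last ≡ 0
  descending-last = trans (cong (λ i → T ∸ X i) (toℕ-fromℕ (suc t))) (ℕ.n∸n≡0 T)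

  farLeaf : Far.extend (node (leaf last)) ≡ 0ℚ
  farLeaf = trans (Far.extend-leaf last) (cong toℚ descending-last)

  extraBall-far : ∀ {p r} → p ∈B extraBall r → Far.extend p ℚ.≤ toℚ (suc r)
  extraBall-far {p} {r} d =
    subst (Far.extend p ℚ.≤_) (trans (cong (ℚ._+ toℚ (suc r)) farLeaf) (ℚ.+-identityˡ (toℚ (suc r)))) (Far.extend-≤-dist d)

  witness-not-extra : ∀ {b o r} (o<K : o < K) → r < n → ¬ (witness b o o<K ∈B extraBall r)
  witness-not-extra {b} {o} {r} o<K r<n d = ℕ.<⇒≱ (s≤s r<n) (begin
    suc n                           ≤⟨ n<L∸height b ⟩
    L ∸ height b                     ≤⟨ ℕ.∸-monoˡ-≤ (height b) (ℕ.m≤n+m L (T ∸ X o)) ⟩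
    (T ∸ X o + L) ∸ height b         ≤⟨ toℚ-cancel-≤ (subst (ℚ._≤ toℚ (suc r)) far-value (extraBall-far {witness b o o<K} {r} d)) ⟩
    suc r                            ∎)
    where
    open ℕ.≤-Reasoning
    far-value : Far.extend (witness b o o<K) ≡ toℚ ((T ∸ X o + L) ∸ height b)
    far-value = trans (witness-far b o<K) (sym (toℚ-∸ (ℕ.≤-trans (ℕ.<⇒≤ (height<L b)) (ℕ.m≤n+m L (T ∸ X o)))))

  L∸[L∸suc] : ∀ {r} → r < n → toℚ L ℚ.- toℚ (L ∸ suc r) ≡ toℚ (suc r)
  L∸[L∸suc] {r} r<n = trans (sym (toℚ-∸ (ℕ.m∸n≤m L (suc r)))) (cong toℚ (ℕ.m∸[m∸n]≡n (s≤s (ℕ.≤-trans (ℕ.<⇒≤ r<n) (ℕ.m≤n+m n R)))))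

  farPoint-in : ∀ {r′ r} (r′<n : r′ < n) → r′ ≤ r → farPoint r′ r′<n ∈B extraBall r
  farPoint-in {r′} {r} r′<n r′≤r =
    _ , enterTgt (fromNode (castWalk refl (sym (tgt-leg last)) refl (here (leaf last)))) , bound
    where
    length≡ : 0ℚ ℚ.+ (len caterpillar (leg last) ℚ.- toℚ (L ∸ suc r′)) ≡ toℚ (suc r′)
    length≡ = trans (ℚ.+-identityˡ _)
      (trans (cong (λ ℓ → toℚ ℓ ℚ.- toℚ (L ∸ suc r′)) (length-leg last)) (L∸[L∸suc] r′<n))
    bound : 0ℚ ℚ.+ (len caterpillar (leg last) ℚ.- toℚ (L ∸ suc r′)) ℚ.≤ toℚ (suc r)
    bound = subst (ℚ._≤ toℚ (suc r)) (sym length≡) (toℚ-mono-≤ (s≤s r′≤r))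

  farPoint-out : ∀ {r′ r} (r′<n : r′ < n) → r < r′ → ¬ (farPoint r′ r′<n ∈B extraBall r)
  farPoint-out {r′} {r} r′<n r<r′ d = ℕ.<⇒≱ (s≤s r<r′) (toℚ-cancel-≤ (subst (ℚ._≤ toℚ (suc r)) far-value (extraBall-far {farPoint r′ r′<n} {r} d)))
    where
    far-value : Far.extend (farPoint r′ r′<n) ≡ toℚ (suc r′)
    far-value = begin
      Far.extend (farPoint r′ r′<n)                     ≡⟨ Far.extend-onLeg-down {last} {L ∸ suc r′} {0<L∸suc r′<n} {L∸suc<L r′} refl ⟩
      toℚ (descending last + L) ℚ.- toℚ (L ∸ suc r′)    ≡⟨ cong (λ d → toℚ (d + L) ℚ.- toℚ (L ∸ suc r′)) descending-last ⟩
      toℚ L ℚ.- toℚ (L ∸ suc r′)                        ≡⟨ L∸[L∸suc] r′<n ⟩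
      toℚ (suc r′)                                      ∎
      where open ≡-Reasoning

  witness-∈-balls : ∀ {b o} (d : Dyadic c b o) (i : Fin n) →
    (witness b o (Dyadic-start< d) ∈B balls i → InRange o (2 ^ b) (toℕ i)) ×
    (InRange o (2 ^ b) (toℕ i) → witness b o (Dyadic-start< d) ∈B balls i)
  witness-∈-balls {b} {o} d i with toℕ i <? K
  ... | yes i<K = in-block , witness-in-main d (Dyadic-start< d) i<K
    where
    in-block : witness b o (Dyadic-start< d) ∈B mainBall (toℕ i) i<K → InRange o (2 ^ b) (toℕ i)
    in-block w∈ with InRange? o (2 ^ b) (toℕ i)
    ... | yes i∈ = i∈
    ... | no i∉ = contradiction (witness-near (Dyadic-start< d) i<K (Dyadic-level≤ d) w∈) (ℕ.<⇒≱ (pos-far d i<K i∉))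
  ... | no i≮K = (λ w∈ → contradiction w∈ (witness-not-extra {b} (Dyadic-start< d) (extra<n i)))
               , (λ i∈ → contradiction (ℕ.<-≤-trans (proj₂ i∈) (Dyadic-end≤ d)) i≮K)

  private
    SameSet-sym : ∀ (B B′ : Ball caterpillar) → SameSet B B′ → SameSet B′ B
    SameSet-sym _ _ same p = proj₂ (same p) , proj₁ (same p)

  main-ball-unique : ∀ i j → toℕ i < K → SameSet (balls i) (balls j) → i ≡ j
  main-ball-unique i j i<K same = toℕ-injective (sym (InRange-unit (proj₁ (witness-∈-balls d j)
    (proj₁ (same (witness 0 (toℕ i) (Dyadic-start< d))) (proj₂ (witness-∈-balls d i) (InRange-start (toℕ i) (s≤s z≤n)))))))
    where
    d : Dyadic c 0 (toℕ i)
    d = Dyadic-unit c i<K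

  extra-ball-unique : ∀ i j → ¬ toℕ i < K → ¬ toℕ j < K → SameSet (balls i) (balls j) → i ≡ j
  extra-ball-unique i j i≮K j≮K same with toℕ i <? K | toℕ j <? K
  ... | yes i<K | _ = contradiction i<K i≮K
  ... | no _ | yes j<K = contradiction j<K j≮K
  ... | no _ | no _ with ℕ.<-cmp (toℕ i ∸ K) (toℕ j ∸ K)
  ...   | tri< ri<rj _ _ = contradiction (proj₂ (same (farPoint _ (extra<n j))) (farPoint-in (extra<n j) ℕ.≤-refl))
                                         (farPoint-out (extra<n j) ri<rj)
  ...   | tri> _ _ rj<ri = contradiction (proj₁ (same (farPoint _ (extra<n i))) (farPoint-in (extra<n i) ℕ.≤-refl))
                                         (farPoint-out (extra<n i) rj<ri)
  ...   | tri≈ _ ri≡rj _ = toℕ-injective (begin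
    toℕ i            ≡⟨ ℕ.m∸n+n≡m (ℕ.≮⇒≥ i≮K) ⟨
    toℕ i ∸ K + K    ≡⟨ cong (_+ K) ri≡rj ⟩
    toℕ j ∸ K + K    ≡⟨ ℕ.m∸n+n≡m (ℕ.≮⇒≥ j≮K) ⟩
    toℕ j            ∎)
    where open ≡-Reasoning

  balls-injective : ∀ i j → SameSet (balls i) (balls j) → i ≡ j
  balls-injective i j same = by-cases (toℕ i <? K) (toℕ j <? K)
    where
    by-cases : Dec (toℕ i < K) → Dec (toℕ j < K) → i ≡ j
    by-cases (yes i<K) _ = main-ball-unique i j i<K same
    by-cases (no _) (yes j<K) = sym (main-ball-unique j i j<K (SameSet-sym (balls i) (balls j) same))
    by-cases (no i≮K) (no j≮K) = extra-ball-unique i j i≮K j≮K same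

  balls-distinct : Distinct balls
  balls-distinct i j i≢j same = i≢j (balls-injective i j same)

  open Colourings

  K≤n : K ≤ n
  K≤n = ℕ.≤-trans 2^c≤t (ℕ.<⇒≤ t<n)

  not-conflictFree : ∀ col → ¬ ConflictFree balls col
  not-conflictFree col cf = ℕ.<-irrefl refl (AllDyadicUnique⇒< c 0 colour unique)
    where
    junk : Fin c
    junk = col (fromℕ< (ℕ.≤-<-trans z≤n t<n))
    colour : ℕ → Fin c
    colour = extendColouring col junk
    unique : AllDyadicUnique colour c 0
    unique {b} {o} d = ConflictFree⇒HasUniqueColour {B = balls} {col} junk cf (witness b o (Dyadic-start< d))
      (ℕ.≤-trans (Dyadic-end≤ d) K≤n) (ℕ.m^n>0 2 b) (witness-∈-balls d)

  ¬Sufficient : ¬ Sufficient t n c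
  ¬Sufficient sufficient with sufficient caterpillar caterpillar-tree caterpillar-internalNodes balls balls-distinct
  ... | col , cf = not-conflictFree col cf

lemma9 : ∀ (t n : ℕ) → 1 ≤ t → suc t ≤ n →
    ∀ (c : ℕ) → Sufficient t n c → ⌈log₂ (t + 1) ⌉ ≤ c
lemma9 t n _ t<n c sufficient with suc t ≤? 2 ^ c
... | yes t+1≤2^c = ≤-trans (⌈log₂⌉-mono-≤ (subst (_≤ 2 ^ c) (+-comm 1 t) t+1≤2^c)) (≤-reflexive (⌈log₂2^n⌉≡n c))
... | no t+1≰2^c = ⊥-elim (LowerBound.¬Sufficient t c n (s≤s⁻¹ (≰⇒> t+1≰2^c)) t<n sufficient)
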